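{- Let $N \equiv 14 \pmod{16}$. Let $EOEE$ and $OEOE$ denote the numbers of partitions of $N$ into exactly two part sizes lying in the respective parity classes. Then $$EOEE + OEOE \equiv \frac{d(N)}{2} \pmod 4,$$ where $d(N)$ is the number of positive divisors of $N$.
   Context: A partition with exactly two part sizes is written $(\lambda_1^{m_1}\lambda_2^{m_2})$ with $\lambda_1>\lambda_2\ge1$ the part sizes and $m_1,m_2\ge1$ their multiplicities. Its parity class is the word $ABCD$ over $\{O,E\}$ where $A,B,C,D$ record whether $\lambda_1, m_1, \lambda_2, m_2$ respectively are odd ($O$) or even ($E$). -}

module Defs where

open import Data.Nat using (ℕ; zero; suc; _+_; _*_; _<_; _≤_; _≟_; _<?_; _≤?_)
open import Data.Nat.Divisibility using (_∣_; _∣?_)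
open import Data.Bool using (Bool; true; false; _∧_; T?)
open import Data.Nat.Base using (_%_)
open import Data.List using (List; length; filter; upTo; cartesianProduct; map)
open import Data.Product using (_×_; _,_)
open import Relation.Nullary.Decidable using (⌊_⌋; _×-dec_)
open import Relation.Binary.PropositionalEquality using (_≡_)

data Parity : Set where
  O E : Parity

parity : ℕ → Parity
parity n with n % 2
... | zero = E
... | suc _ = O

_≟P_ : Parity → Parity → Bool
O ≟P O = true
E ≟P E = true
_ ≟P _ = false

range1 : ℕ → List ℕ
range1 n = map suc (upTo n)

-- A partition of N with exactly two part sizes (λ₁^m₁ λ₂^m₂), λ₁ > λ₂ ≥ 1,
-- m₁, m₂ ≥ 1, is determined by the quadruple (λ₁, m₁, λ₂, m₂) with
-- λ₁ * m₁ + λ₂ * m₂ = N.  All four components lie in 1..N.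
Quad : Set
Quad = ℕ × ℕ × ℕ × ℕ

candidates : ℕ → List Quad
candidates N =
  cartesianProduct (range1 N)
    (cartesianProduct (range1 N) (cartesianProduct (range1 N) (range1 N)))

isTwoSizePartition : ℕ → Quad → Bool
isTwoSizePartition N (l₁ , m₁ , l₂ , m₂) =
  ⌊ l₂ <? l₁ ⌋ ∧ ⌊ l₁ * m₁ + l₂ * m₂ ≟ N ⌋

-- parity class ABCD = parities of λ₁, m₁, λ₂, m₂
hasClass : Parity → Parity → Parity → Parity → Quad → Bool
hasClass a b c d (l₁ , m₁ , l₂ , m₂) =
  (parity l₁ ≟P a) ∧ (parity m₁ ≟P b) ∧ (parity l₂ ≟P c) ∧ (parity m₂ ≟P d)

countClass : Parity → Parity → Parity → Parity → ℕ → ℕ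
countClass a b c d N =
  length (filter (λ q → T? (isTwoSizePartition N q ∧ hasClass a b c d q))
                 (candidates N))

numDivisors : ℕ → ℕ
numDivisors N = length (filter (λ k → k ∣? N) (range1 N))

-- Conjugation (λ₁^m₁ λ₂^m₂) ↦ ((m₁+m₂)^λ₂ m₁^(λ₁−λ₂)) maps the class ABCD onto the class
-- (B+D) C B (A+C), so EOEE + OEOE = 2X where X counts the OEOE partitions of N.
--
-- Let R be the OEOE-shaped solutions of λ₁m₁ + λ₂m₂ = N with the order λ₁ > λ₂ dropped, and count R
-- twice by pairing its elements with involutions. Swapping the two parts gives |R| = 2X + |λ₁ = λ₂|.
-- On λ₁ = λ₂, swapping the multiplicities is fixed-point free as N ≡ 2 (mod 4), and on m₁ < m₂ the
-- reflection m₁ ↦ (m₁+m₂)/2 + 1 − m₁ fixes exactly the quadruples (k, b, k, 3b − 2) with k(2b − 1) = N/2,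
-- i.e. one for each of the K odd divisors k ≡ 1 (mod 4) of N. So |R| = 2X + 4r + 2K for some r.
-- On the other hand exactly one multiplicity is divisible by 4, so swapping the parts halves R, and the
-- involutions (λ₁, m₁) ↦ (m₁/2, 2λ₁) and (λ₂, m₂) ↦ (m₂/4, 4λ₂) show 4 ∣ |R|: the fixed points of the
-- last one would give N = 2λ₁² + 4λ₂² ≡ 6 (mod 16). Hence 2X ≡ 2K (mod 4).
--
-- Finally the even divisors of N are twice the odd ones, and k ↦ (N/2)/k pairs the odd divisors so that
-- exactly one member of each pair is ≡ 1 (mod 4), because N/2 ≡ 3 (mod 4). Thus d(N)/2 = 2K.

module Submission where

open import Defs
open import Data.Nat using (ℕ; _+_; _/_; _%_)
open import Relation.Binary.PropositionalEquality using (_≡_)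

open import Data.Bool using (T; _∧_)
open import Data.Bool.Properties using (T-∧)
open import Data.List using (List; []; _∷_; length; filter; map)
open import Data.List.Membership.Propositional using (_∈_)
open import Data.List.Membership.Propositional.Properties using (∈-filter⁺; ∈-filter⁻; ∈-map⁺; ∈-map⁻; ∈-cartesianProduct⁺; ∈-cartesianProduct⁻; ∈-upTo⁺)
open import Data.List.Membership.Propositional.Properties.WithK using (unique∧set⇒bag)
open import Data.List.Properties using (filter-≐; filter-none; length-map; map-∘; map-id-local)
open import Data.List.Relation.Binary.BagAndSetEquality using (∼bag⇒↭)
open import Data.List.Relation.Binary.Permutation.Propositional.Properties using (↭-length)
open import Data.List.Relation.Unary.All as All using (All)
open import Data.List.Relation.Unary.All.Properties using (all-filter)
open import Data.List.Relation.Unary.Any using (here; there)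
open import Data.List.Relation.Unary.Unique.Propositional using (Unique)
open import Data.List.Relation.Unary.Unique.Propositional.Properties using (filter⁺; map⁺; map⁻; upTo⁺; cartesianProduct⁺)
open import Data.Nat hiding (parity)
open import Data.Nat.DivMod
open import Data.Nat.Divisibility using (_∣_; _∣?_; divides; ∣-trans; ∣-refl; ∣-reflexive; ∣⇒≤; m∣m*n; n∣m*n; ∣n⇒∣m*n; *-pres-∣; n∣m⇒m%n≡0; m%n≡0⇒n∣m; 0∣⇒≡0)
open import Data.Nat.Properties
open import Data.Nat.Tactic.RingSolver using (solve-∀)
open import Data.Product using (_×_; _,_; proj₁; proj₂)
open import Data.Product.Function.NonDependent.Propositional using (_×-⇔_)
open import Data.Sum using (_⊎_; inj₁; inj₂; [_,_]′)
open import Data.Unit using (tt)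
open import Function.Base using (_∘_; id)
open import Function.Bundles using (_⇔_; mk⇔; Equivalence)
open import Function.Properties.Equivalence using () renaming (trans to ⇔-trans)
open import Level using (0ℓ)
open import Relation.Binary.Definitions using (tri<; tri≈; tri>)
open import Relation.Binary.PropositionalEquality hiding ([_])
open import Relation.Nullary using (¬_; yes; no)
open import Relation.Nullary.Decidable using (_×-dec_; toWitness; fromWitness)
open import Relation.Nullary.Negation using (contradiction)
open import Relation.Unary using (Pred; Decidable; _⊆_; _∩_; ∁)
open import Relation.Unary.Properties using (_∩?_; ∁?)

-- Counting by involutions

count : {A : Set} {P : Pred A 0ℓ} → Decidable P → List A → ℕ
count P? xs = length (filter P? xs)

module _ {A : Set} {P : Pred A 0ℓ} (P? : Decidable P) where

  count-∩-∁ : {R : Pred A 0ℓ} (R? : Decidable R) (xs : List A) →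
              count P? xs ≡ count (P? ∩? R?) xs + count (P? ∩? ∁? R?) xs
  count-∩-∁ R? []       = refl
  count-∩-∁ R? (x ∷ xs) with P? x | R? x
  ... | yes _ | yes _ = cong suc (count-∩-∁ R? xs)
  ... | yes _ | no  _ = trans (cong suc (count-∩-∁ R? xs)) (sym (+-suc _ _))
  ... | no  _ | _     = count-∩-∁ R? xs

  count-cong-∈ : {Q : Pred A 0ℓ} (Q? : Decidable Q) (xs : List A) →
                 (∀ {x} → x ∈ xs → P x → Q x) → (∀ {x} → x ∈ xs → Q x → P x) →
                 count P? xs ≡ count Q? xs
  count-cong-∈ Q? []       P⇒Q Q⇒P = refl
  count-cong-∈ Q? (x ∷ xs) P⇒Q Q⇒P with P? x | Q? x
  ... | yes _  | yes _  = cong suc (count-cong-∈ Q? xs (P⇒Q ∘ there) (Q⇒P ∘ there))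
  ... | no  _  | no  _  = count-cong-∈ Q? xs (P⇒Q ∘ there) (Q⇒P ∘ there)
  ... | yes px | no ¬qx = contradiction (P⇒Q (here refl) px) ¬qx
  ... | no ¬px | yes qx = contradiction (Q⇒P (here refl) qx) ¬px

  count-none : (xs : List A) → (∀ {x} → ¬ P x) → count P? xs ≡ 0
  count-none xs ¬P = cong length (filter-none P? (All.universal (λ _ → ¬P) xs))

module _ {A B : Set} {P : Pred A 0ℓ} {Q : Pred B 0ℓ} (P? : Decidable P) (Q? : Decidable Q)
         {xs : List A} {ys : List B} (xs! : Unique xs) (ys! : Unique ys)
         (P⊆xs : P ⊆ (_∈ xs)) (Q⊆ys : Q ⊆ (_∈ ys)) where

  count-≡-by-inverses : (f : A → B) (g : B → A) →
                        (∀ {x} → P x → Q (f x)) → (∀ {y} → Q y → P (g y)) →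
                        (∀ {x} → P x → g (f x) ≡ x) → (∀ {y} → Q y → f (g y) ≡ y) →
                        count P? xs ≡ count Q? ys
  count-≡-by-inverses f g f-Q g-P g∘f f∘g = begin
    count P? xs        ≡⟨ length-map f Ps ⟨
    length (map f Ps)  ≡⟨ ↭-length (∼bag⇒↭ (unique∧set⇒bag map-unique (filter⁺ Q? ys!) (mk⇔ to from))) ⟩
    count Q? ys        ∎
    where
    open ≡-Reasoning
    Ps = filter P? xs
    -- g undoes f on P, which makes map f injective on Ps.
    g∘f-on-Ps : map g (map f Ps) ≡ Ps
    g∘f-on-Ps = trans (sym (map-∘ {g = g} {f = f} Ps)) (map-id-local (All.map g∘f (all-filter P? xs)))
    map-unique : Unique (map f Ps)
    map-unique = map⁻ {f = g} (subst Unique (sym g∘f-on-Ps) (filter⁺ P? xs!))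
    to : ∀ {y} → y ∈ map f Ps → y ∈ filter Q? ys
    to y∈ with ∈-map⁻ f y∈
    ... | x , x∈ , refl = ∈-filter⁺ Q? (Q⊆ys Qfx) Qfx
      where Qfx = f-Q (proj₂ (∈-filter⁻ P? {xs = xs} x∈))
    from : ∀ {y} → y ∈ filter Q? ys → y ∈ map f Ps
    from y∈ = subst (_∈ map f Ps) (f∘g Qy) (∈-map⁺ f (∈-filter⁺ P? (P⊆xs (g-P Qy)) (g-P Qy)))
      where Qy = proj₂ (∈-filter⁻ Q? {xs = ys} y∈)

module _ {A : Set} {P : Pred A 0ℓ} (P? : Decidable P) (u v : A → ℕ) where

  private
    u<v? : Decidable (λ x → u x < v x)
    u<v? x = u x <? v x
    v<u? : Decidable (λ x → v x < u x)
    v<u? x = v x <? u x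
    u≡v? : Decidable (λ x → u x ≡ v x)
    u≡v? x = u x ≟ v x

  count-trichotomy : ∀ xs → count P? xs ≡ count (P? ∩? u<v?) xs + count (P? ∩? v<u?) xs + count (P? ∩? u≡v?) xs
  count-trichotomy xs = begin
    count P? xs                                                  ≡⟨ count-∩-∁ P? u<v? xs ⟩
    count (P? ∩? u<v?) xs + count (P? ∩? ∁? u<v?) xs               ≡⟨ cong (count (P? ∩? u<v?) xs +_) (count-∩-∁ (P? ∩? ∁? u<v?) v<u? xs) ⟩
    count (P? ∩? u<v?) xs + (count ((P? ∩? ∁? u<v?) ∩? v<u?) xs
                            + count ((P? ∩? ∁? u<v?) ∩? ∁? v<u?) xs) ≡⟨ cong₂ (λ m n → count (P? ∩? u<v?) xs + (m + n))
                                                                        (cong length (filter-≐ _ _ (to-v<u , from-v<u) xs))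
                                                                        (cong length (filter-≐ _ _ (to-u≡v , from-u≡v) xs)) ⟩
    count (P? ∩? u<v?) xs + (count (P? ∩? v<u?) xs + count (P? ∩? u≡v?) xs) ≡⟨ +-assoc (count (P? ∩? u<v?) xs) _ _ ⟨
    count (P? ∩? u<v?) xs + count (P? ∩? v<u?) xs + count (P? ∩? u≡v?) xs ∎
    where
    open ≡-Reasoning
    to-v<u : ∀ {x} → (P x × ¬ u x < v x) × v x < u x → P x × v x < u x
    to-v<u ((p , _) , g) = p , g
    from-v<u : ∀ {x} → P x × v x < u x → (P x × ¬ u x < v x) × v x < u x
    from-v<u (p , g) = (p , <-asym g) , g
    to-u≡v : ∀ {x} → (P x × ¬ u x < v x) × ¬ v x < u x → P x × u x ≡ v x
    to-u≡v {x} ((p , ¬l) , ¬g) with <-cmp (u x) (v x)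
    ... | tri< l _ _ = contradiction l ¬l
    ... | tri≈ _ e _ = p , e
    ... | tri> _ _ g = contradiction g ¬g
    from-u≡v : ∀ {x} → P x × u x ≡ v x → (P x × ¬ u x < v x) × ¬ v x < u x
    from-u≡v (p , e) = (p , <-irrefl e) , <-irrefl (sym e)

  module _ {xs : List A} (xs! : Unique xs) (P⊆xs : P ⊆ (_∈ xs))
           (f : A → A) (f-P : ∀ {x} → P x → P (f x)) (f-involutive : ∀ {x} → P x → f (f x) ≡ x)
           (u∘f≡v : ∀ {x} → P x → u (f x) ≡ v x) where

    count-by-involution : count P? xs ≡ 2 * count (P? ∩? u<v?) xs + count (P? ∩? u≡v?) xs
    count-by-involution = begin
      count P? xs    ≡⟨ count-trichotomy xs ⟩
      #< + #> + #≡   ≡⟨ cong (λ n → #< + n + #≡) #>≡#< ⟩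
      #< + #< + #≡   ≡⟨ cong (λ n → #< + n + #≡) (+-identityʳ #<) ⟨
      2 * #< + #≡    ∎
      where
      open ≡-Reasoning
      #< #> #≡ : ℕ
      #< = count (P? ∩? u<v?) xs
      #> = count (P? ∩? v<u?) xs
      #≡ = count (P? ∩? u≡v?) xs
      v∘f≡u : ∀ {x} → P x → v (f x) ≡ u x
      v∘f≡u p = trans (sym (u∘f≡v (f-P p))) (cong u (f-involutive p))
      #>≡#< : #> ≡ #<
      #>≡#< = count-≡-by-inverses (P? ∩? v<u?) (P? ∩? u<v?) xs! xs! (P⊆xs ∘ proj₁) (P⊆xs ∘ proj₁) f f
        (λ (p , g) → f-P p , subst₂ _<_ (sym (u∘f≡v p)) (sym (v∘f≡u p)) g)
        (λ (p , l) → f-P p , subst₂ _<_ (sym (v∘f≡u p)) (sym (u∘f≡v p)) l)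
        (f-involutive ∘ proj₁) (f-involutive ∘ proj₁)

    count-by-fixpoint-free-involution : (∀ {x} → P x → u x ≢ v x) → count P? xs ≡ 2 * count (P? ∩? u<v?) xs
    count-by-fixpoint-free-involution u≢v = begin
      count P? xs                                     ≡⟨ count-by-involution ⟩
      2 * count (P? ∩? u<v?) xs + count (P? ∩? u≡v?) xs ≡⟨ cong (2 * count (P? ∩? u<v?) xs +_) (count-none (P? ∩? u≡v?) xs (λ (p , e) → u≢v p e)) ⟩
      2 * count (P? ∩? u<v?) xs + 0                    ≡⟨ +-identityʳ _ ⟩
      2 * count (P? ∩? u<v?) xs                        ∎
      where open ≡-Reasoning

module _ (x y : ℕ) {r s : ℕ} (n : ℕ) .{{_ : NonZero n}} where

  %-+ : x % n ≡ r → y % n ≡ s → (x + y) % n ≡ (r + s) % n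
  %-+ x≡r y≡s = trans (%-distribˡ-+ x y n) (cong₂ (λ a b → (a + b) % n) x≡r y≡s)

  %-* : x % n ≡ r → y % n ≡ s → (x * y) % n ≡ (r * s) % n
  %-* x≡r y≡s = trans (%-distribˡ-* x y n) (cong₂ (λ a b → (a * b) % n) x≡r y≡s)

%-∣ : ∀ x {r} d n .{{_ : NonZero d}} .{{_ : NonZero n}} → d ∣ n → x % n ≡ r → x % d ≡ r % d
%-∣ x d n d∣n x≡r = trans (sym (m∣n⇒o%n%m≡o%m d n x d∣n)) (cong (_% d) x≡r)

bit : Parity → ℕ
bit O = 1
bit E = 0

HasParity : Parity → ℕ → Set
HasParity p n = n % 2 ≡ bit p

Odd Even : ℕ → Set
Odd = HasParity O
Even = HasParity E

hasParity? : ∀ p → Decidable (HasParity p)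
hasParity? p n = n % 2 ≟ bit p

parity-correct : ∀ n → HasParity (parity n) n
parity-correct n with n % 2 | m%n<n n 2
... | 0           | _ = refl
... | 1           | _ = refl
... | suc (suc _) | s≤s (s≤s ())

parity-unique : ∀ n {p q} → HasParity p n → HasParity q n → p ≡ q
parity-unique _ {O} {O} _ _ = refl
parity-unique _ {E} {E} _ _ = refl
parity-unique _ {O} {E} p q with () ← trans (sym p) q
parity-unique _ {E} {O} p q with () ← trans (sym p) q

even⊎odd : ∀ n → Even n ⊎ Odd n
even⊎odd n with parity n | parity-correct n
... | O | n-odd  = inj₂ n-odd
... | E | n-even = inj₁ n-even

¬odd⇒even : ∀ n → ¬ Odd n → Even n
¬odd⇒even n ¬odd with even⊎odd n
... | inj₁ n-even = n-even
... | inj₂ n-odd  = contradiction n-odd ¬odd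

_⊕_ : Parity → Parity → Parity
O ⊕ O = E
O ⊕ E = O
E ⊕ O = O
E ⊕ E = E

⊕-comm : ∀ p q → p ⊕ q ≡ q ⊕ p
⊕-comm O O = refl
⊕-comm O E = refl
⊕-comm E O = refl
⊕-comm E E = refl

⊕-cancelʳ : ∀ p q → (p ⊕ q) ⊕ q ≡ p
⊕-cancelʳ O O = refl
⊕-cancelʳ O E = refl
⊕-cancelʳ E O = refl
⊕-cancelʳ E E = refl

+-parity : ∀ p q {x y} → HasParity p x → HasParity q y → HasParity (p ⊕ q) (x + y)
+-parity p q {x} {y} px qy = trans (%-+ x y 2 px qy) (bit-⊕ p q)
  where
  bit-⊕ : ∀ p q → (bit p + bit q) % 2 ≡ bit (p ⊕ q)
  bit-⊕ O O = refl
  bit-⊕ O E = refl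
  bit-⊕ E O = refl
  bit-⊕ E E = refl

∸-parity : ∀ p q {x y} → y ≤ x → HasParity p x → HasParity q y → HasParity (p ⊕ q) (x ∸ y)
∸-parity p q {x} {y} y≤x px qy = subst (λ r → HasParity r (x ∸ y)) r≡p⊕q (parity-correct (x ∸ y))
  where
  r = parity (x ∸ y)
  x-parity : HasParity (r ⊕ q) x
  x-parity = subst (HasParity (r ⊕ q)) (m∸n+n≡m y≤x) (+-parity r q {x ∸ y} {y} (parity-correct (x ∸ y)) qy)
  r≡p⊕q : r ≡ p ⊕ q
  r≡p⊕q = trans (sym (⊕-cancelʳ r q)) (cong (_⊕ q) (parity-unique x x-parity px))

odd⇒pos : ∀ {n} → Odd n → 0 < n
odd⇒pos {suc n} _ = z<s

even⇒≡half*2 : ∀ n → Even n → n ≡ n / 2 * 2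
even⇒≡half*2 n n-even = trans (m≡m%n+[m/n]*n n 2) (cong (_+ n / 2 * 2) n-even)

odd-*⁻ˡ : ∀ x y → Odd (x * y) → Odd x
odd-*⁻ˡ x y xy-odd with even⊎odd x | even⊎odd y
... | inj₂ x-odd  | _          = x-odd
... | inj₁ x-even | inj₁ y-even with () ← trans (sym xy-odd) (%-* x y 2 x-even y-even)
... | inj₁ x-even | inj₂ y-odd  with () ← trans (sym xy-odd) (%-* x y 2 x-even y-odd)

odd-%4 : ∀ n → Odd n → n % 4 ≡ 1 ⊎ n % 4 ≡ 3
odd-%4 n n-odd = residue (n % 4) (m%n<n n 4) (trans (m∣n⇒o%n%m≡o%m 2 4 n (divides 2 refl)) n-odd)
  where
  residue : ∀ r → r < 4 → r % 2 ≡ 1 → r ≡ 1 ⊎ r ≡ 3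
  residue 1 _ _ = inj₁ refl
  residue 3 _ _ = inj₂ refl
  residue 0 _ ()
  residue 2 _ ()
  residue (suc (suc (suc (suc _)))) (s≤s (s≤s (s≤s (s≤s ())))) _

even-%4 : ∀ n → Even n → n % 4 ≡ 0 ⊎ n % 4 ≡ 2
even-%4 n n-even = residue (n % 4) (m%n<n n 4) (trans (m∣n⇒o%n%m≡o%m 2 4 n (divides 2 refl)) n-even)
  where
  residue : ∀ r → r < 4 → r % 2 ≡ 0 → r ≡ 0 ⊎ r ≡ 2
  residue 0 _ _ = inj₁ refl
  residue 2 _ _ = inj₂ refl
  residue 1 _ ()
  residue 3 _ ()
  residue (suc (suc (suc (suc _)))) (s≤s (s≤s (s≤s (s≤s ())))) _

odd-square-%8 : ∀ n → Odd n → n * n % 8 ≡ 1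
odd-square-%8 n n-odd =
  trans (%-distribˡ-* n n 8) (residue (n % 8) (m%n<n n 8) (trans (m∣n⇒o%n%m≡o%m 2 8 n (divides 4 refl)) n-odd))
  where
  residue : ∀ r → r < 8 → r % 2 ≡ 1 → r * r % 8 ≡ 1
  residue 1 _ _ = refl
  residue 3 _ _ = refl
  residue 5 _ _ = refl
  residue 7 _ _ = refl
  residue 0 _ ()
  residue 2 _ ()
  residue 4 _ ()
  residue 6 _ ()
  residue (suc (suc (suc (suc (suc (suc (suc (suc _)))))))) (s≤s (s≤s (s≤s (s≤s (s≤s (s≤s (s≤s (s≤s ())))))))) _

twice-odd-square-%16 : ∀ a → Odd a → a * (a * 2) % 16 ≡ 2
twice-odd-square-%16 a a-odd = begin
  a * (a * 2) % 16   ≡⟨ cong (_% 16) (*-assoc a a 2) ⟨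
  a * a * 2 % 16     ≡⟨ m%n*o≡m*o%[n*o] (a * a) 8 2 ⟨
  a * a % 8 * 2      ≡⟨ cong (_* 2) (odd-square-%8 a a-odd) ⟩
  2                  ∎
  where open ≡-Reasoning

odd*even-%4 : ∀ a b → Odd a → Even b → a * b % 4 ≡ b % 4
odd*even-%4 a b a-odd b-even with odd-%4 a a-odd | even-%4 b b-even
... | inj₁ a≡1 | inj₁ b≡0 = trans (%-* a b 4 a≡1 b≡0) (sym b≡0)
... | inj₁ a≡1 | inj₂ b≡2 = trans (%-* a b 4 a≡1 b≡2) (sym b≡2)
... | inj₂ a≡3 | inj₁ b≡0 = trans (%-* a b 4 a≡3 b≡0) (sym b≡0)
... | inj₂ a≡3 | inj₂ b≡2 = trans (%-* a b 4 a≡3 b≡2) (sym b≡2)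

quotient-%2 : ∀ n k .{{_ : NonZero k}} .{{_ : NonZero (2 * k)}} → k ∣ n → n / k % 2 * k ≡ n % (2 * k)
quotient-%2 n k k∣n = trans (m%n*o≡m*o%[n*o] (n / k) 2 k) (cong (_% (2 * k)) (m/n*n≡m k∣n))

odd-quotient : ∀ n k .{{_ : NonZero k}} .{{_ : NonZero (2 * k)}} → n % (2 * k) ≡ k → Odd (n / k)
odd-quotient n k n≡k = *-cancelʳ-≡ (n / k % 2) 1 k (trans (quotient-%2 n k k∣n) (trans n≡k (sym (*-identityˡ k))))
  where
  k∣n : k ∣ n
  k∣n = m%n≡0⇒n∣m n k (trans (%-∣ n k (2 * k) (n∣m*n 2) n≡k) (n%n≡0 k))

even-quotient : ∀ n k .{{_ : NonZero k}} .{{_ : NonZero (2 * k)}} → n % (2 * k) ≡ 0 → Even (n / k)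
even-quotient n k n≡0 = *-cancelʳ-≡ (n / k % 2) 0 k (trans (quotient-%2 n k k∣n) n≡0)
  where
  k∣n : k ∣ n
  k∣n = ∣-trans (n∣m*n 2) (m%n≡0⇒n∣m n (2 * k) n≡0)

m+m<n+n⇒m<n : ∀ {m n} → m + m < n + n → m < n
m+m<n+n⇒m<n m+m<n+n = ≰⇒> (λ n≤m → <⇒≱ m+m<n+n (+-mono-≤ n≤m n≤m))

even∧pos⇒≥2 : ∀ {n} → Even n → 0 < n → 2 ≤ n
even∧pos⇒≥2 {suc (suc _)} _ _ = s≤s (s≤s z≤n)

odd∣double⇒∣ : ∀ k m → Odd k → k ∣ m * 2 → k ∣ m
odd∣double⇒∣ k m k-odd (divides q m*2≡q*k) = divides (q / 2) (*-cancelʳ-≡ m (q / 2 * k) 2 (begin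
  m * 2          ≡⟨ m*2≡q*k ⟩
  q * k          ≡⟨ cong (_* k) (even⇒≡half*2 q q-even) ⟩
  q / 2 * 2 * k  ≡⟨ swap-factors (q / 2) k ⟩
  q / 2 * k * 2  ∎))
  where
  open ≡-Reasoning
  swap-factors : ∀ x y → x * 2 * y ≡ x * y * 2
  swap-factors = solve-∀
  q-even : Even q
  q-even = ¬odd⇒even q λ q-odd → contradiction (begin
    1              ≡⟨ %-* q k 2 q-odd k-odd ⟨
    q * k % 2      ≡⟨ cong (_% 2) m*2≡q*k ⟨
    m * 2 % 2      ≡⟨ m*n%n≡0 m 2 ⟩
    0              ∎) λ ()

-- Total division with m ÷ 0 = 0, so that `cofactor` below is defined on all of ℕ.
infixl 7 _÷_

_÷_ : ℕ → ℕ → ℕ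
m ÷ zero  = zero
m ÷ suc n = m / suc n

m*n÷n≡m : ∀ m n → 0 < n → m * n ÷ n ≡ m
m*n÷n≡m m (suc n) _ = m*n/n≡m m (suc n)

m÷n*n≡m : ∀ {m n} → 0 < n → n ∣ m → m ÷ n * n ≡ m
m÷n*n≡m {n = suc n} _ n∣m = m/n*n≡m n∣m

odd-%4-< : ∀ x y → Odd x → Odd y → x % 4 < y % 4 → x % 4 ≡ 1 × y % 4 ≡ 3
odd-%4-< x y x-odd y-odd x<y with odd-%4 x x-odd | odd-%4 y y-odd
... | inj₁ x≡1 | inj₂ y≡3 = x≡1 , y≡3
... | inj₁ x≡1 | inj₁ y≡1 = contradiction (subst₂ _<_ x≡1 y≡1 x<y) (<-irrefl refl)
... | inj₂ x≡3 | inj₁ y≡1 = contradiction (subst₂ _<_ x≡3 y≡1 x<y) λ { (s≤s ()) }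
... | inj₂ x≡3 | inj₂ y≡3 = contradiction (subst₂ _<_ x≡3 y≡3 x<y) (<-irrefl refl)

even-%4-< : ∀ x y → Even x → Even y → x % 4 < y % 4 → x % 4 ≡ 0 × y % 4 ≡ 2
even-%4-< x y x-even y-even x<y with even-%4 x x-even | even-%4 y y-even
... | inj₁ x≡0 | inj₂ y≡2 = x≡0 , y≡2
... | inj₁ x≡0 | inj₁ y≡0 = contradiction (subst₂ _<_ x≡0 y≡0 x<y) (<-irrefl refl)
... | inj₂ x≡2 | inj₁ y≡0 = contradiction (subst₂ _<_ x≡2 y≡0 x<y) λ ()
... | inj₂ x≡2 | inj₂ y≡2 = contradiction (subst₂ _<_ x≡2 y≡2 x<y) (<-irrefl refl)

even-*ʳ : ∀ m n → Even n → Even (m * n)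
even-*ʳ m n n-even = trans (%-distribˡ-* m n 2) (trans (cong (λ x → m % 2 * x % 2) n-even) (cong (_% 2) (*-zeroʳ (m % 2))))

m+m≡m*2 : ∀ m → m + m ≡ m * 2
m+m≡m*2 m = trans (cong (m +_) (sym (+-identityʳ m))) (*-comm 2 m)

double-≡-mod-4 : ∀ x y r s → x + y + r * 2 ≡ s * 2 → (x + x) % 4 ≡ (y + y) % 4
double-≡-mod-4 x y r s x+y+2r≡2s = begin
  (x + x) % 4  ≡⟨ cong (_% 4) (m+m≡m*2 x) ⟩
  x * 2 % 4    ≡⟨ m%n*o≡m*o%[n*o] x 2 2 ⟨
  x % 2 * 2    ≡⟨ cong (_* 2) same-parity ⟩
  y % 2 * 2    ≡⟨ m%n*o≡m*o%[n*o] y 2 2 ⟩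
  y * 2 % 4    ≡⟨ cong (_% 4) (m+m≡m*2 y) ⟨
  (y + y) % 4  ∎
  where
  open ≡-Reasoning
  x+y-even : Even (x + y)
  x+y-even = trans (sym ([m+kn]%n≡m%n (x + y) r 2)) (trans (cong (_% 2) x+y+2r≡2s) (m*n%n≡0 s 2))
  same-parity : x % 2 ≡ y % 2
  same-parity with even⊎odd x | even⊎odd y
  ... | inj₁ x-even | inj₁ y-even = trans x-even (sym y-even)
  ... | inj₂ x-odd  | inj₂ y-odd  = trans x-odd (sym y-odd)
  ... | inj₁ x-even | inj₂ y-odd  = contradiction (trans (sym x+y-even) (%-+ x y 2 x-even y-odd)) λ ()
  ... | inj₂ x-odd  | inj₁ y-even = contradiction (trans (sym x+y-even) (%-+ x y 2 x-odd y-even)) λ ()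

half-%4 : ∀ n → n % 8 ≡ 6 → n / 2 % 4 ≡ 3
half-%4 n n%8≡6 = *-cancelʳ-≡ (n / 2 % 4) 3 2 (begin
  n / 2 % 4 * 2  ≡⟨ m%n*o≡m*o%[n*o] (n / 2) 4 2 ⟩
  n / 2 * 2 % 8  ≡⟨ cong (_% 8) (even⇒≡half*2 n (%-∣ n 2 8 (divides 4 refl) n%8≡6)) ⟨
  n % 8          ≡⟨ n%8≡6 ⟩
  6              ∎)
  where open ≡-Reasoning

total : Quad → ℕ
total (a , b , c , d) = a * b + c * d

Positive : Pred Quad 0ℓ
Positive (a , b , c , d) = 0 < a × 0 < b × 0 < c × 0 < d

HasClass : Parity → Parity → Parity → Parity → Pred Quad 0ℓ
HasClass A B C D (a , b , c , d) = HasParity A a × HasParity B b × HasParity C c × HasParity D d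

-- The class predicate of `countClass` without the order λ₁ > λ₂ (see `Ordered`), and with the
-- positivity that membership in `candidates` provides.
TwoSize : Parity → Parity → Parity → Parity → ℕ → Pred Quad 0ℓ
TwoSize A B C D N q = total q ≡ N × Positive q × HasClass A B C D q

Ordered : Pred Quad 0ℓ
Ordered (a , b , c , d) = c < a

TwoSize? : ∀ A B C D N → Decidable (TwoSize A B C D N)
TwoSize? A B C D N q@(a , b , c , d) =
  total q ≟ N ×-dec
  (0 <? a ×-dec 0 <? b ×-dec 0 <? c ×-dec 0 <? d) ×-dec
  (hasParity? A a ×-dec hasParity? B b ×-dec hasParity? C c ×-dec hasParity? D d)

Ordered? : Decidable Ordered
Ordered? (a , b , c , d) = c <? a

range1-unique : ∀ N → Unique (range1 N)
range1-unique N = map⁺ suc-injective (upTo⁺ N)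

∈-range1⁺ : ∀ {N x} → 0 < x → x ≤ N → x ∈ range1 N
∈-range1⁺ {x = suc x} _ x<N = ∈-map⁺ suc (∈-upTo⁺ x<N)

∈-range1⇒pos : ∀ {N x} → x ∈ range1 N → 0 < x
∈-range1⇒pos x∈ with ∈-map⁻ suc x∈
... | _ , _ , refl = z<s

candidates-unique : ∀ N → Unique (candidates N)
candidates-unique N =
  cartesianProduct⁺ (range1-unique N) (cartesianProduct⁺ (range1-unique N) (cartesianProduct⁺ (range1-unique N) (range1-unique N)))

∈-candidates⇒Positive : ∀ {N q} → q ∈ candidates N → Positive q
∈-candidates⇒Positive {N} {a , b , c , d} q∈ with ∈-cartesianProduct⁻ (range1 N) _ q∈
... | a∈ , bcd∈ with ∈-cartesianProduct⁻ (range1 N) _ bcd∈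
... | b∈ , cd∈ with ∈-cartesianProduct⁻ (range1 N) (range1 N) cd∈
... | c∈ , d∈ = ∈-range1⇒pos a∈ , ∈-range1⇒pos b∈ , ∈-range1⇒pos c∈ , ∈-range1⇒pos d∈

TwoSize⊆candidates : ∀ {A B C D N} → TwoSize A B C D N ⊆ (_∈ candidates N)
TwoSize⊆candidates {N = N} {a , b , c , d} (refl , (a>0 , b>0 , c>0 , d>0) , _) =
  ∈-cartesianProduct⁺ (∈-range1⁺ a>0 a≤N) (∈-cartesianProduct⁺ (∈-range1⁺ b>0 b≤N)
    (∈-cartesianProduct⁺ (∈-range1⁺ c>0 c≤N) (∈-range1⁺ d>0 d≤N)))
  where
  instance
    _ = >-nonZero a>0
    _ = >-nonZero b>0
    _ = >-nonZero c>0
    _ = >-nonZero d>0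
  a≤N = ≤-trans (m≤m*n a b) (m≤m+n (a * b) (c * d))
  b≤N = ≤-trans (m≤n*m b a) (m≤m+n (a * b) (c * d))
  c≤N = ≤-trans (m≤m*n c d) (m≤n+m (c * d) (a * b))
  d≤N = ≤-trans (m≤n*m d c) (m≤n+m (c * d) (a * b))

T-≟P : ∀ {p q} → T (p ≟P q) ⇔ p ≡ q
T-≟P {O} {O} = mk⇔ (λ _ → refl) (λ _ → tt)
T-≟P {E} {E} = mk⇔ (λ _ → refl) (λ _ → tt)
T-≟P {O} {E} = mk⇔ (λ ()) (λ ())
T-≟P {E} {O} = mk⇔ (λ ()) (λ ())

T-parity : ∀ p n → T (parity n ≟P p) ⇔ HasParity p n
T-parity p n = ⇔-trans T-≟P (mk⇔ (λ { refl → parity-correct n }) (parity-unique n (parity-correct n)))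

T-hasClass : ∀ A B C D q → T (hasClass A B C D q) ⇔ HasClass A B C D q
T-hasClass A B C D (a , b , c , d) =
  ⇔-trans T-∧ (T-parity A a ×-⇔ ⇔-trans T-∧ (T-parity B b ×-⇔ ⇔-trans T-∧ (T-parity C c ×-⇔ T-parity D d)))

T-isTwoSizePartition : ∀ N q → T (isTwoSizePartition N q) ⇔ (Ordered q × total q ≡ N)
T-isTwoSizePartition N (a , b , c , d) =
  ⇔-trans T-∧ (mk⇔ (toWitness {a? = c <? a}) fromWitness ×-⇔ mk⇔ (toWitness {a? = a * b + c * d ≟ N}) fromWitness)

countClass≡count-TwoSize : ∀ A B C D N → countClass A B C D N ≡ count (TwoSize? A B C D N ∩? Ordered?) (candidates N)
countClass≡count-TwoSize A B C D N = count-cong-∈ _ _ (candidates N) class⇒TwoSize TwoSize⇒class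
  where
  open Equivalence
  class⇒TwoSize : ∀ {q} → q ∈ candidates N → T (isTwoSizePartition N q ∧ hasClass A B C D q) → TwoSize A B C D N q × Ordered q
  class⇒TwoSize {q} q∈ t with to T-∧ t
  ... | t₁ , t₂ with to (T-isTwoSizePartition N q) t₁
  ... | ordered , total≡N = (total≡N , ∈-candidates⇒Positive {N} q∈ , to (T-hasClass A B C D q) t₂) , ordered
  TwoSize⇒class : ∀ {q} → q ∈ candidates N → TwoSize A B C D N q × Ordered q → T (isTwoSizePartition N q ∧ hasClass A B C D q)
  TwoSize⇒class {q} _ ((total≡N , _ , cls) , ordered) =
    from T-∧ (from (T-isTwoSizePartition N q) (ordered , total≡N) , from (T-hasClass A B C D q) cls)

-- Conjugation

conjugate : Quad → Quad
conjugate (a , b , c , d) = (b + d , c , b , a ∸ c)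

conjugate-involutive : ∀ {q} → Ordered q → conjugate (conjugate q) ≡ q
conjugate-involutive {a , b , c , d} c<a = cong₂ _,_ (m+[n∸m]≡n (<⇒≤ c<a)) (cong (λ d → b , c , d) (m+n∸m≡n b d))

conjugate-TwoSize : ∀ {A B C D N q} → TwoSize A B C D N q × Ordered q →
                    TwoSize (B ⊕ D) C B (A ⊕ C) N (conjugate q) × Ordered (conjugate q)
conjugate-TwoSize {A} {B} {C} {D} {q = a , b , c , d} ((total≡N , (a>0 , b>0 , c>0 , d>0) , (pa , pb , pc , pd)) , c<a) =
  (trans total-conjugate total≡N ,
   (≤-trans b>0 (m≤m+n b d) , c>0 , b>0 , m<n⇒0<n∸m c<a) ,
   (+-parity B D {b} {d} pb pd , pc , pb , ∸-parity A C {a} {c} (<⇒≤ c<a) pa pc)) ,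
  m<m+n b d>0
  where
  rearrange : ∀ b c d e → (b + d) * c + b * e ≡ (c + e) * b + c * d
  rearrange = solve-∀
  total-conjugate : (b + d) * c + b * (a ∸ c) ≡ a * b + c * d
  total-conjugate = trans (rearrange b c d (a ∸ c)) (cong (λ a → a * b + c * d) (m+[n∸m]≡n (<⇒≤ c<a)))

countClass-conjugate : ∀ A B C D N → countClass A B C D N ≡ countClass (B ⊕ D) C B (A ⊕ C) N
countClass-conjugate A B C D N = begin
  countClass A B C D N                                   ≡⟨ countClass≡count-TwoSize A B C D N ⟩
  count (TwoSize? A B C D N ∩? Ordered?) (candidates N)  ≡⟨ count-≡-by-inverses _ _ (candidates-unique N) (candidates-unique N)
                                                              (TwoSize⊆candidates {N = N} ∘ proj₁) (TwoSize⊆candidates {N = N} ∘ proj₁)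
                                                              conjugate conjugate conjugate-TwoSize back
                                                              (conjugate-involutive ∘ proj₂) (conjugate-involutive ∘ proj₂) ⟩
  count (TwoSize? (B ⊕ D) C B (A ⊕ C) N ∩? Ordered?) (candidates N) ≡⟨ countClass≡count-TwoSize (B ⊕ D) C B (A ⊕ C) N ⟨
  countClass (B ⊕ D) C B (A ⊕ C) N                       ∎
  where
  open ≡-Reasoning
  back : ∀ {q} → TwoSize (B ⊕ D) C B (A ⊕ C) N q × Ordered q → TwoSize A B C D N (conjugate q) × Ordered (conjugate q)
  back {q} h = subst₂ (λ A D → TwoSize A B C D N (conjugate q) × Ordered (conjugate q))
                      (trans (⊕-comm C (A ⊕ C)) (⊕-cancelʳ A C))
                      (trans (cong (_⊕ B) (⊕-comm B D)) (⊕-cancelʳ D B))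
                      (conjugate-TwoSize h)

size₁ mult₁ size₂ mult₂ : Quad → ℕ
size₁ (a , _ , _ , _) = a
mult₁ (_ , b , _ , _) = b
size₂ (_ , _ , c , _) = c
mult₂ (_ , _ , _ , d) = d

swapParts : Quad → Quad
swapParts (a , b , c , d) = (c , d , a , b)

module _ (N : ℕ) where

  Rep : Pred Quad 0ℓ
  Rep = TwoSize O E O E N

  Rep? : Decidable Rep
  Rep? = TwoSize? O E O E N

  Rep⊆candidates : Rep ⊆ (_∈ candidates N)
  Rep⊆candidates = TwoSize⊆candidates

  swapParts-Rep : ∀ {q} → Rep q → Rep (swapParts q)
  swapParts-Rep {a , b , c , d} (total≡N , (a>0 , b>0 , c>0 , d>0) , (pa , pb , pc , pd)) =
    trans (+-comm (c * d) (a * b)) total≡N , (c>0 , d>0 , a>0 , b>0) , (pc , pd , pa , pb)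

  count-Rep-by-order : count Rep? (candidates N) ≡
    2 * count (Rep? ∩? Ordered?) (candidates N) + count (Rep? ∩? λ q → size₂ q ≟ size₁ q) (candidates N)
  count-Rep-by-order = count-by-involution Rep? size₂ size₁ (candidates-unique N) Rep⊆candidates
                         swapParts swapParts-Rep (λ _ → refl) (λ _ → refl)

  mults-differ-mod-4 : N % 4 ≡ 2 → ∀ {q} → Rep q → mult₁ q % 4 ≢ mult₂ q % 4
  mults-differ-mod-4 N%4≡2 {a , b , c , d} (total≡N , _ , (a-odd , b-even , c-odd , d-even)) b≡d =
    [ (λ d≡0 → 2≢0 (2≡r+r d≡0)) , (λ d≡2 → 2≢0 (2≡r+r d≡2)) ]′ (even-%4 d d-even)
    where
    2≢0 : 2 ≢ 0
    2≢0 ()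
    2≡r+r : ∀ {r} → d % 4 ≡ r → 2 ≡ (r + r) % 4
    2≡r+r {r} d≡r = begin
      2                       ≡⟨ N%4≡2 ⟨
      N % 4                   ≡⟨ cong (_% 4) total≡N ⟨
      (a * b + c * d) % 4     ≡⟨ %-+ (a * b) (c * d) 4 (trans (odd*even-%4 a b a-odd b-even) (trans b≡d d≡r))
                                                       (trans (odd*even-%4 c d c-odd d-even) d≡r) ⟩
      (r + r) % 4             ∎
      where open ≡-Reasoning

-- Counting through the diagonal λ₁ = λ₂

swapMults : Quad → Quad
swapMults (a , b , c , d) = (a , d , c , b)

-- When λ₁ = λ₂, the sum s = m₁ + m₂ is determined by N; reflectMults is m₁ ↦ s/2 + 1 − m₁, keeping s.
pivot : Quad → ℕ
pivot (_ , b , _ , d) = suc ((b + d) / 2)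

reflectMults : Quad → Quad
reflectMults q@(a , b , c , d) = (a , pivot q ∸ b , c , b + d ∸ (pivot q ∸ b))

module _ (N : ℕ) where

  Diagonal : Pred Quad 0ℓ
  Diagonal = Rep N ∩ λ q → size₂ q ≡ size₁ q

  Diagonal? : Decidable Diagonal
  Diagonal? = Rep? N ∩? λ q → size₂ q ≟ size₁ q

  Diagonal< : Pred Quad 0ℓ
  Diagonal< = Diagonal ∩ λ q → mult₁ q < mult₂ q

  Diagonal<? : Decidable Diagonal<
  Diagonal<? = Diagonal? ∩? λ q → mult₁ q <? mult₂ q

  diagonal-total : ∀ {a b c d} → Diagonal (a , b , c , d) → a * (b + d) ≡ N
  diagonal-total {a} {b} {c} {d} ((total≡N , _) , refl) = trans (*-distribˡ-+ a b d) total≡N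

  swapMults-Diagonal : ∀ {q} → Diagonal q → Diagonal (swapMults q)
  swapMults-Diagonal {a , b , c , d} ((total≡N , (a>0 , b>0 , c>0 , d>0) , (pa , pb , pc , pd)) , refl) =
    (trans (+-comm (a * d) (a * b)) total≡N , (a>0 , d>0 , c>0 , b>0) , (pa , pd , pc , pb)) , refl

  module _ (N%4≡2 : N % 4 ≡ 2) where

    count-Diagonal : count Diagonal? (candidates N) ≡ 2 * count Diagonal<? (candidates N)
    count-Diagonal = count-by-fixpoint-free-involution Diagonal? mult₁ mult₂ (candidates-unique N)
                       (Rep⊆candidates N ∘ proj₁) swapMults swapMults-Diagonal (λ _ → refl) (λ _ → refl)
                       (λ (rep , _) b≡d → mults-differ-mod-4 N N%4≡2 rep (cong (_% 4) b≡d))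

    module Reflection {a b d : ℕ} (a*s≡N : a * (b + d) ≡ N) (a-odd : Odd a)
                      (b-even : Even b) (d-even : Even d) (b>0 : 0 < b) (b<d : b < d) where

      s t : ℕ
      s = b + d
      t = s / 2

      s-even : Even s
      s-even = +-parity E E {b} {d} b-even d-even

      s≡t*2 : s ≡ t * 2
      s≡t*2 = even⇒≡half*2 s s-even

      s≡t+t : s ≡ t + t
      s≡t+t = trans s≡t*2 (sym (m+m≡m*2 t))

      t-odd : Odd t
      t-odd = odd-quotient s 2 (begin
        s % 4      ≡⟨ odd*even-%4 a s a-odd s-even ⟨
        a * s % 4  ≡⟨ cong (_% 4) a*s≡N ⟩
        N % 4      ≡⟨ N%4≡2 ⟩
        2          ∎)
        where open ≡-Reasoning

      b<t : b < t
      b<t = m+m<n+n⇒m<n (subst (b + b <_) s≡t+t (+-monoʳ-< b b<d))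

      b≤pivot : b ≤ suc t
      b≤pivot = m<n⇒m≤1+n b<t

      pivot-even : Even (suc t)
      pivot-even = +-parity O O {1} {t} refl t-odd

      b′ d′ : ℕ
      b′ = suc t ∸ b
      d′ = s ∸ b′

      b′<t : b′ < t
      b′<t = s≤s⁻¹ (begin
        suc (suc b′)  ≡⟨ +-comm 2 b′ ⟩
        b′ + 2        ≤⟨ +-monoʳ-≤ b′ (even∧pos⇒≥2 b-even b>0) ⟩
        b′ + b        ≡⟨ m∸n+n≡m b≤pivot ⟩
        suc t         ∎)
        where open ≤-Reasoning

      b′+d′≡s : b′ + d′ ≡ s
      b′+d′≡s = m+[n∸m]≡n (≤-trans (<⇒≤ b′<t) (subst (t ≤_) (sym s≡t+t) (m≤m+n t t)))

      b′<d′ : b′ < d′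
      b′<d′ = +-cancelˡ-< b′ b′ d′ (subst (b′ + b′ <_) (trans (sym s≡t+t) (sym b′+d′≡s)) (+-mono-< b′<t b′<t))

      b′>0 : 0 < b′
      b′>0 = m<n⇒0<n∸m (m<n⇒m<1+n b<t)

      b′-even : Even b′
      b′-even = ∸-parity E E {suc t} {b} b≤pivot pivot-even b-even

      d′-even : Even d′
      d′-even = ∸-parity E E {s} {b′} (subst (b′ ≤_) b′+d′≡s (m≤m+n b′ d′)) s-even b′-even

    reflectMults-Diagonal< : ∀ {q} → Diagonal< q → Diagonal< (reflectMults q)
    reflectMults-Diagonal< {a , b , c , d} h@(((_ , (a>0 , b>0 , _ , _) , (a-odd , b-even , _ , d-even)) , refl) , b<d) =
      ((total-image , (a>0 , b′>0 , a>0 , <-trans b′>0 b′<d′) , (a-odd , b′-even , a-odd , d′-even)) , refl) , b′<d′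
      where
      open Reflection {a} {b} {d} (diagonal-total (proj₁ h)) a-odd b-even d-even b>0 b<d
      total-image : a * b′ + a * d′ ≡ N
      total-image = trans (sym (*-distribˡ-+ a b′ d′)) (trans (cong (a *_) b′+d′≡s) (diagonal-total (proj₁ h)))

    reflectMults-involutive : ∀ {q} → Diagonal< q → reflectMults (reflectMults q) ≡ q
    reflectMults-involutive {a , b , c , d} h@(((_ , (_ , b>0 , _ , _) , (a-odd , b-even , _ , d-even)) , _) , b<d) = begin
      reflectMults (a , b′ , c , d′)              ≡⟨ cong (λ x → a , suc (x / 2) ∸ b′ , c , x ∸ (suc (x / 2) ∸ b′)) b′+d′≡s ⟩
      (a , suc t ∸ b′ , c , s ∸ (suc t ∸ b′))     ≡⟨ cong (λ y → a , y , c , s ∸ y) (m∸[m∸n]≡n b≤pivot) ⟩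
      (a , b , c , s ∸ b)                         ≡⟨ cong (λ z → a , b , c , z) (m+n∸m≡n b d) ⟩
      (a , b , c , d)                             ∎
      where
      open ≡-Reasoning
      open Reflection {a} {b} {d} (diagonal-total (proj₁ h)) a-odd b-even d-even b>0 b<d

    count-Diagonal< : count Diagonal<? (candidates N) ≡
      2 * count (Diagonal<? ∩? λ q → mult₁ q <? pivot q ∸ mult₁ q) (candidates N)
        + count (Diagonal<? ∩? λ q → mult₁ q ≟ pivot q ∸ mult₁ q) (candidates N)
    count-Diagonal< = count-by-involution Diagonal<? mult₁ (λ q → pivot q ∸ mult₁ q) (candidates-unique N)
                        (Rep⊆candidates N ∘ proj₁ ∘ proj₁) reflectMults reflectMults-Diagonal<
                        reflectMults-involutive (λ _ → refl)

-- Divisors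

module _ (N : ℕ) where

  Divisor : Pred ℕ 0ℓ
  Divisor k = k ∣ N

  Divisor? : Decidable Divisor
  Divisor? k = k ∣? N

  OddDivisor : Pred ℕ 0ℓ
  OddDivisor = Divisor ∩ Odd

  OddDivisor? : Decidable OddDivisor
  OddDivisor? = Divisor? ∩? hasParity? O

  cofactor : ℕ → ℕ
  cofactor k = N / 2 ÷ k

  Divisor⊆range1 : 0 < N → ∀ {k} → Divisor k → k ∈ range1 N
  Divisor⊆range1 N>0 {k} k∣N = ∈-range1⁺ k>0 (∣⇒≤ k∣N)
    where
    instance _ = >-nonZero N>0
    k>0 : 0 < k
    k>0 = n≢0⇒n>0 (λ { refl → <⇒≢ N>0 (sym (0∣⇒≡0 k∣N)) })

  module _ (N%4≡2 : N % 4 ≡ 2) where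

    N>0 : 0 < N
    N>0 = n≢0⇒n>0 λ { refl → contradiction N%4≡2 λ () }

    N≡N/2*2 : N ≡ N / 2 * 2
    N≡N/2*2 = even⇒≡half*2 N (%-∣ N 2 4 (divides 2 refl) N%4≡2)

    ¬4∣N : ¬ 4 ∣ N
    ¬4∣N 4∣N = contradiction (trans (sym N%4≡2) (n∣m⇒m%n≡0 N 4 4∣N)) λ ()

    odd-divisor-∣-half : ∀ {k} → OddDivisor k → k ∣ N / 2
    odd-divisor-∣-half {k} (k∣N , k-odd) = odd∣double⇒∣ k (N / 2) k-odd (subst (k ∣_) N≡N/2*2 k∣N)

    halve-even-divisor : ∀ {k} → (Divisor ∩ ∁ Odd) k → OddDivisor (k / 2)
    halve-even-divisor {k} (k∣N , k-not-odd) = ∣-trans (m∣m*n 2) (subst (_∣ N) k≡j*2 k∣N) , odd-quotient k 2 k%4≡2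
      where
      k-even = ¬odd⇒even k k-not-odd
      k≡j*2 = even⇒≡half*2 k k-even
      k%4≡2 : k % 4 ≡ 2
      k%4≡2 = [ (λ k%4≡0 → contradiction (∣-trans (m%n≡0⇒n∣m k 4 k%4≡0) k∣N) ¬4∣N) , id ]′ (even-%4 k k-even)

    double-odd-divisor : ∀ {j} → OddDivisor j → (Divisor ∩ ∁ Odd) (j * 2)
    double-odd-divisor {j} d = subst (j * 2 ∣_) (sym N≡N/2*2) (*-pres-∣ (odd-divisor-∣-half d) ∣-refl) ,
                               λ odd → contradiction (trans (sym odd) (m*n%n≡0 j 2)) λ ()

    numDivisors≡2*oddDivisors : numDivisors N ≡ 2 * count OddDivisor? (range1 N)
    numDivisors≡2*oddDivisors = begin
      numDivisors N    ≡⟨ count-∩-∁ Divisor? (hasParity? O) (range1 N) ⟩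
      #odd + #even     ≡⟨ cong (#odd +_) evens≡odds ⟩
      #odd + #odd      ≡⟨ cong (#odd +_) (+-identityʳ #odd) ⟨
      2 * #odd         ∎
      where
      open ≡-Reasoning
      #odd #even : ℕ
      #odd = count OddDivisor? (range1 N)
      #even = count (Divisor? ∩? ∁? (hasParity? O)) (range1 N)
      evens≡odds : #even ≡ #odd
      evens≡odds = count-≡-by-inverses _ _ (range1-unique N) (range1-unique N)
                     (Divisor⊆range1 N>0 ∘ proj₁) (Divisor⊆range1 N>0 ∘ proj₁) (_/ 2) (_* 2)
                     halve-even-divisor double-odd-divisor
                     (λ {k} (_ , k-not-odd) → sym (even⇒≡half*2 k (¬odd⇒even k k-not-odd)))
                     (λ {j} _ → m*n/n≡m j 2)

    module _ (N/2%4≡3 : N / 2 % 4 ≡ 3) where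

      private
        N/2-odd : Odd (N / 2)
        N/2-odd = %-∣ (N / 2) 2 4 (divides 2 refl) N/2%4≡3

      cofactor-spec : ∀ {k} → OddDivisor k → N / 2 ≡ cofactor k * k
      cofactor-spec d@(_ , k-odd) = sym (m÷n*n≡m (odd⇒pos k-odd) (odd-divisor-∣-half d))

      cofactor-OddDivisor : ∀ {k} → OddDivisor k → OddDivisor (cofactor k)
      cofactor-OddDivisor {k} d =
        ∣-trans (m∣m*n k) (∣-trans (∣-reflexive (sym (cofactor-spec d))) (subst (N / 2 ∣_) (sym N≡N/2*2) (m∣m*n 2))) ,
        odd-*⁻ˡ (cofactor k) k (subst Odd (cofactor-spec d) N/2-odd)

      cofactor-involutive : ∀ {k} → OddDivisor k → cofactor (cofactor k) ≡ k
      cofactor-involutive {k} d = trans (cong (_÷ cofactor k) (trans (cofactor-spec d) (*-comm (cofactor k) k)))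
                                        (m*n÷n≡m k (cofactor k) (odd⇒pos (proj₂ (cofactor-OddDivisor d))))

      cofactor-residue-differs : ∀ {k} → OddDivisor k → k % 4 ≢ cofactor k % 4
      cofactor-residue-differs {k} d@(_ , k-odd) k≡c =
        [ (λ k≡1 → contradiction (3≡r*r k≡1) λ ()) , (λ k≡3 → contradiction (3≡r*r k≡3) λ ()) ]′ (odd-%4 k k-odd)
        where
        3≡r*r : ∀ {r} → k % 4 ≡ r → 3 ≡ r * r % 4
        3≡r*r k≡r = trans (sym N/2%4≡3) (trans (cong (_% 4) (cofactor-spec d)) (%-* (cofactor k) k 4 (trans (sym k≡c) k≡r) k≡r))

      count-odd-divisors : count OddDivisor? (range1 N) ≡ 2 * count (OddDivisor? ∩? λ k → k % 4 <? cofactor k % 4) (range1 N)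
      count-odd-divisors =
        count-by-fixpoint-free-involution OddDivisor? (_% 4) (λ k → cofactor k % 4) (range1-unique N)
          (Divisor⊆range1 N>0 ∘ proj₁) cofactor cofactor-OddDivisor cofactor-involutive (λ _ → refl) cofactor-residue-differs

module _ (N : ℕ) where

  Central : Pred Quad 0ℓ
  Central = Diagonal< N ∩ λ q → mult₁ q ≡ pivot q ∸ mult₁ q

  Central? : Decidable Central
  Central? = Diagonal<? N ∩? λ q → mult₁ q ≟ pivot q ∸ mult₁ q

  OddDivisor< : Pred ℕ 0ℓ
  OddDivisor< = OddDivisor N ∩ λ k → k % 4 < cofactor N k % 4

  OddDivisor<? : Decidable OddDivisor<
  OddDivisor<? = OddDivisor? N ∩? λ k → k % 4 <? cofactor N k % 4

  -- The central quadruple (k, b, k, 3b − 2) with 2b − 1 = cofactor k.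
  fromDivisor : ℕ → Quad
  fromDivisor k = (k , B , k , cofactor N k * 2 ∸ B)
    where B = suc (cofactor N k) / 2

  module _ (N%4≡2 : N % 4 ≡ 2) (N/2%4≡3 : N / 2 % 4 ≡ 3) where

    module CentralFacts {a b d : ℕ} (a*s≡N : a * (b + d) ≡ N) (a-odd : Odd a) (b-even : Even b) (d-even : Even d)
                        (b>0 : 0 < b) (b<d : b < d) (central : b ≡ suc ((b + d) / 2) ∸ b) where

      open Reflection N N%4≡2 {a} {b} {d} a*s≡N a-odd b-even d-even b>0 b<d public

      suc-t≡b*2 : suc t ≡ b * 2
      suc-t≡b*2 = begin
        suc t            ≡⟨ m∸n+n≡m b≤pivot ⟨
        suc t ∸ b + b    ≡⟨ cong (_+ b) central ⟨
        b + b            ≡⟨ m+m≡m*2 b ⟩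
        b * 2            ∎
        where open ≡-Reasoning

      N/2≡t*a : N / 2 ≡ t * a
      N/2≡t*a = *-cancelʳ-≡ (N / 2) (t * a) 2 (begin
        N / 2 * 2      ≡⟨ N≡N/2*2 N N%4≡2 ⟨
        N              ≡⟨ a*s≡N ⟨
        a * s          ≡⟨ cong (a *_) s≡t*2 ⟩
        a * (t * 2)    ≡⟨ *-assoc a t 2 ⟨
        a * t * 2      ≡⟨ cong (_* 2) (*-comm a t) ⟩
        t * a * 2      ∎)
        where open ≡-Reasoning

      cofactor≡t : cofactor N a ≡ t
      cofactor≡t = trans (cong (_÷ a) N/2≡t*a) (m*n÷n≡m t a (odd⇒pos a-odd))

      t%4≡3 : t % 4 ≡ 3
      t%4≡3 = %-pred-≡0 {t} {4} (begin
        suc t % 4  ≡⟨ cong (_% 4) suc-t≡b*2 ⟩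
        b * 2 % 4  ≡⟨ m%n*o≡m*o%[n*o] b 2 2 ⟨
        b % 2 * 2  ≡⟨ cong (_* 2) b-even ⟩
        0          ∎)
        where open ≡-Reasoning

      a%4≡1 : a % 4 ≡ 1
      a%4≡1 with odd-%4 a a-odd
      ... | inj₁ a≡1 = a≡1
      ... | inj₂ a≡3 = contradiction (begin
        3          ≡⟨ N/2%4≡3 ⟨
        N / 2 % 4  ≡⟨ cong (_% 4) N/2≡t*a ⟩
        t * a % 4  ≡⟨ %-* t a 4 t%4≡3 a≡3 ⟩
        1          ∎) λ ()
        where open ≡-Reasoning

    Central⇒OddDivisor< : ∀ {q} → Central q → OddDivisor< (size₁ q)
    Central⇒OddDivisor< {a , b , c , d} h@(((((_ , (_ , b>0 , _ , _) , (a-odd , b-even , _ , d-even)) , refl) , b<d) , central)) =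
      (divides s (trans (sym a*s≡N) (*-comm a s)) , a-odd) ,
      subst₂ _<_ (sym a%4≡1) (sym (trans (cong (_% 4) cofactor≡t) t%4≡3)) (s≤s (s≤s z≤n))
      where
      a*s≡N = diagonal-total N (proj₁ (proj₁ h))
      open CentralFacts {a} {b} {d} a*s≡N a-odd b-even d-even b>0 b<d central

    fromDivisor∘size₁ : ∀ {q} → Central q → fromDivisor (size₁ q) ≡ q
    fromDivisor∘size₁ {a , b , c , d} h@(((((_ , (_ , b>0 , _ , _) , (a-odd , b-even , _ , d-even)) , refl) , b<d) , central)) = begin
      fromDivisor a                              ≡⟨ cong (λ x → a , suc x / 2 , a , x * 2 ∸ suc x / 2) cofactor≡t ⟩
      (a , suc t / 2 , a , t * 2 ∸ suc t / 2)    ≡⟨ cong (λ y → a , y , a , t * 2 ∸ y) (trans (cong (_/ 2) suc-t≡b*2) (m*n/n≡m b 2)) ⟩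
      (a , b , a , t * 2 ∸ b)                    ≡⟨ cong (λ z → a , b , a , z) (trans (cong (_∸ b) (sym s≡t*2)) (m+n∸m≡n b d)) ⟩
      (a , b , a , d)                            ∎
      where
      open ≡-Reasoning
      open CentralFacts {a} {b} {d} (diagonal-total N (proj₁ (proj₁ h))) a-odd b-even d-even b>0 b<d central

    module FromDivisor {k : ℕ} (h : OddDivisor< k) where

      c B D : ℕ
      c = cofactor N k
      B = suc c / 2
      D = c * 2 ∸ B

      k-odd : Odd k
      k-odd = proj₂ (proj₁ h)

      c-odd : Odd c
      c-odd = proj₂ (cofactor-OddDivisor N N%4≡2 N/2%4≡3 (proj₁ h))

      c%4≡3 : c % 4 ≡ 3
      c%4≡3 = proj₂ (odd-%4-< k c k-odd c-odd (proj₂ h))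

      suc-c%4≡0 : suc c % 4 ≡ 0
      suc-c%4≡0 = %-+ 1 c 4 refl c%4≡3

      B+B≡suc-c : B + B ≡ suc c
      B+B≡suc-c = trans (m+m≡m*2 B) (sym (even⇒≡half*2 (suc c) (%-∣ (suc c) 2 4 (divides 2 refl) suc-c%4≡0)))

      B-even : Even B
      B-even = even-quotient (suc c) 2 suc-c%4≡0

      B>0 : 0 < B
      B>0 = n≢0⇒n>0 λ B≡0 → contradiction (trans (sym B+B≡suc-c) (cong (λ x → x + x) B≡0)) λ ()

      1<c : 1 < c
      1<c = <-≤-trans (s≤s (s≤s z≤n)) (subst (_≤ c) c%4≡3 (m%n≤m c 4))

      B<c : B < c
      B<c = m+m<n+n⇒m<n (subst (_< c + c) (sym B+B≡suc-c) (+-monoˡ-< c 1<c))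

      B+D≡c*2 : B + D ≡ c * 2
      B+D≡c*2 = m+[n∸m]≡n (≤-trans (<⇒≤ B<c) (m≤m*n c 2))

      B<D : B < D
      B<D = +-cancelˡ-< B B D (subst (B + B <_) (trans (m+m≡m*2 c) (sym B+D≡c*2)) (+-mono-< B<c B<c))

      D-even : Even D
      D-even = ∸-parity E E {c * 2} {B} (≤-trans (<⇒≤ B<c) (m≤m*n c 2)) (m*n%n≡0 c 2) B-even

      total≡N : k * B + k * D ≡ N
      total≡N = begin
        k * B + k * D     ≡⟨ *-distribˡ-+ k B D ⟨
        k * (B + D)       ≡⟨ cong (k *_) B+D≡c*2 ⟩
        k * (c * 2)       ≡⟨ *-assoc k c 2 ⟨
        k * c * 2         ≡⟨ cong (_* 2) (trans (*-comm k c) (sym (cofactor-spec N N%4≡2 N/2%4≡3 (proj₁ h)))) ⟩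
        N / 2 * 2         ≡⟨ N≡N/2*2 N N%4≡2 ⟨
        N                 ∎
        where open ≡-Reasoning

      B≡pivot∸B : B ≡ suc ((B + D) / 2) ∸ B
      B≡pivot∸B = sym (begin
        suc ((B + D) / 2) ∸ B   ≡⟨ cong (λ x → suc (x / 2) ∸ B) B+D≡c*2 ⟩
        suc (c * 2 / 2) ∸ B     ≡⟨ cong (λ x → suc x ∸ B) (m*n/n≡m c 2) ⟩
        suc c ∸ B               ≡⟨ cong (_∸ B) B+B≡suc-c ⟨
        B + B ∸ B               ≡⟨ m+n∸m≡n B B ⟩
        B                       ∎)
        where open ≡-Reasoning

    fromDivisor-Central : ∀ {k} → OddDivisor< k → Central (fromDivisor k)
    fromDivisor-Central {k} h =
      ((((total≡N , (k>0 , B>0 , k>0 , <-trans B>0 B<D) , (k-odd , B-even , k-odd , D-even)) , refl) , B<D) , B≡pivot∸B)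
      where
      open FromDivisor h
      k>0 = odd⇒pos k-odd

    count-Central : count Central? (candidates N) ≡ count OddDivisor<? (range1 N)
    count-Central = count-≡-by-inverses Central? OddDivisor<? (candidates-unique N) (range1-unique N)
                      (Rep⊆candidates N ∘ proj₁ ∘ proj₁ ∘ proj₁) (Divisor⊆range1 N (N>0 N N%4≡2) ∘ proj₁ ∘ proj₁)
                      size₁ fromDivisor Central⇒OddDivisor< fromDivisor-Central fromDivisor∘size₁ (λ _ → refl)

-- Counting through the residues of the multiplicities modulo 4

rescaleFirst : Quad → Quad
rescaleFirst (a , b , c , d) = (b / 2 , a * 2 , c , d)

rescaleSecond : Quad → Quad
rescaleSecond (a , b , c , d) = (a , b , d / 4 , c * 4)

module _ (N : ℕ) where

  Rep4 : Pred Quad 0ℓ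
  Rep4 = Rep N ∩ λ q → mult₂ q % 4 < mult₁ q % 4

  Rep4? : Decidable Rep4
  Rep4? = Rep? N ∩? λ q → mult₂ q % 4 <? mult₁ q % 4

  Rep4-residues : ∀ {q} → Rep4 q → mult₂ q % 4 ≡ 0 × mult₁ q % 4 ≡ 2
  Rep4-residues {a , b , c , d} ((_ , _ , (_ , b-even , _ , d-even)) , d<b) = even-%4-< d b d-even b-even d<b

  Rep4⇒4∣mult₂ : ∀ {q} → Rep4 q → 4 ∣ mult₂ q
  Rep4⇒4∣mult₂ {q} rep4 = m%n≡0⇒n∣m (mult₂ q) 4 (proj₁ (Rep4-residues rep4))

  count-Rep-by-residues : N % 4 ≡ 2 → count (Rep? N) (candidates N) ≡ 2 * count Rep4? (candidates N)
  count-Rep-by-residues N%4≡2 =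
    count-by-fixpoint-free-involution (Rep? N) (λ q → mult₂ q % 4) (λ q → mult₁ q % 4) (candidates-unique N)
      (Rep⊆candidates N) swapParts (swapParts-Rep N) (λ _ → refl) (λ _ → refl)
      (λ rep d≡b → mults-differ-mod-4 N N%4≡2 rep (sym d≡b))

  rescaleFirst-Rep4 : ∀ {q} → Rep4 q → Rep4 (rescaleFirst q)
  rescaleFirst-Rep4 {a , b , c , d} rep4@((total≡N , (a>0 , b>0 , c>0 , d>0) , (a-odd , b-even , c-odd , d-even)) , d<b) =
    (trans total-image total≡N ,
     (odd⇒pos b/2-odd , ≤-trans (s≤s z≤n) (*-monoˡ-≤ 2 a>0) , c>0 , d>0) ,
     (b/2-odd , m*n%n≡0 a 2 , c-odd , d-even)) ,
    subst₂ _<_ (sym d≡0) (trans (cong (_* 2) (sym a-odd)) (m%n*o≡m*o%[n*o] a 2 2)) (s≤s z≤n)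
    where
    d≡0 = proj₁ (Rep4-residues rep4)
    b/2-odd : Odd (b / 2)
    b/2-odd = odd-quotient b 2 (proj₂ (Rep4-residues rep4))
    total-image : b / 2 * (a * 2) + c * d ≡ a * b + c * d
    total-image = cong (_+ c * d) (begin
      b / 2 * (a * 2)  ≡⟨ swap-factors (b / 2) a ⟩
      a * (b / 2 * 2)  ≡⟨ cong (a *_) (even⇒≡half*2 b b-even) ⟨
      a * b            ∎)
      where
      open ≡-Reasoning
      swap-factors : ∀ x y → x * (y * 2) ≡ y * (x * 2)
      swap-factors = solve-∀

  rescaleFirst-involutive : ∀ {q} → Rep4 q → rescaleFirst (rescaleFirst q) ≡ q
  rescaleFirst-involutive {a , b , c , d} ((_ , _ , (_ , b-even , _ , _)) , _) =
    cong₂ (λ x y → x , y , c , d) (m*n/n≡m a 2) (sym (even⇒≡half*2 b b-even))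

  count-Rep4 : count Rep4? (candidates N) ≡
    2 * count (Rep4? ∩? λ q → mult₁ q <? size₁ q * 2) (candidates N)
      + count (Rep4? ∩? λ q → mult₁ q ≟ size₁ q * 2) (candidates N)
  count-Rep4 = count-by-involution Rep4? mult₁ (λ q → size₁ q * 2) (candidates-unique N) (Rep⊆candidates N ∘ proj₁)
                 rescaleFirst rescaleFirst-Rep4 rescaleFirst-involutive (λ _ → refl)

  Balanced : Pred Quad 0ℓ
  Balanced = Rep4 ∩ λ q → mult₁ q ≡ size₁ q * 2

  Balanced? : Decidable Balanced
  Balanced? = Rep4? ∩? λ q → mult₁ q ≟ size₁ q * 2

  module _ (N%8≡6 : N % 8 ≡ 6) where

    balanced-quarter-odd : ∀ {a b c d} → Balanced (a , b , c , d) → Odd (d / 4)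
    balanced-quarter-odd {a} {b} {c} {d} (rep4@((total≡N , _ , (a-odd , _ , _ , _)) , _) , refl) =
      [ (λ quarter-even → contradiction (6≡2 quarter-even) λ ()) , id ]′ (even⊎odd (d / 4))
      where
      6≡2 : Even (d / 4) → 6 ≡ 2
      6≡2 quarter-even = begin
        6                          ≡⟨ N%8≡6 ⟨
        N % 8                      ≡⟨ cong (_% 8) total≡N ⟨
        (a * (a * 2) + c * d) % 8  ≡⟨ %-+ (a * (a * 2)) (c * d) 8 2a²≡2 cd≡0 ⟩
        2                          ∎
        where
        open ≡-Reasoning
        2a²≡2 : a * (a * 2) % 8 ≡ 2
        2a²≡2 = %-∣ (a * (a * 2)) 8 16 (divides 2 refl) (twice-odd-square-%16 a a-odd)
        d%8≡0 : d % 8 ≡ 0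
        d%8≡0 = trans (sym (quotient-%2 d 4 (Rep4⇒4∣mult₂ rep4))) (cong (_* 4) quarter-even)
        cd≡0 : c * d % 8 ≡ 0
        cd≡0 = n∣m⇒m%n≡0 (c * d) 8 (∣n⇒∣m*n c (m%n≡0⇒n∣m d 8 d%8≡0))

    rescaleSecond-Balanced : ∀ {q} → Balanced q → Balanced (rescaleSecond q)
    rescaleSecond-Balanced {a , b , c , d} h@(rep4@((total≡N , (a>0 , b>0 , c>0 , _) , (a-odd , b-even , _ , _)) , _) , b≡a*2) =
      ((trans total-image total≡N , (a>0 , b>0 , odd⇒pos d/4-odd , ≤-trans (s≤s z≤n) (*-monoˡ-≤ 4 c>0)) ,
        (a-odd , b-even , d/4-odd , even-*ʳ c 4 refl)) ,
       subst₂ _<_ (sym (m*n%n≡0 c 4)) (sym (proj₂ (Rep4-residues rep4))) (s≤s z≤n)) ,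
      b≡a*2
      where
      d/4-odd = balanced-quarter-odd h
      swap-factors : ∀ x y → x * (y * 4) ≡ y * (x * 4)
      swap-factors = solve-∀
      total-image : a * b + d / 4 * (c * 4) ≡ a * b + c * d
      total-image = cong (a * b +_) (trans (swap-factors (d / 4) c) (cong (c *_) (m/n*n≡m (Rep4⇒4∣mult₂ rep4))))

  rescaleSecond-involutive : ∀ {q} → Balanced q → rescaleSecond (rescaleSecond q) ≡ q
  rescaleSecond-involutive {a , b , c , d} (rep4 , _) =
    cong₂ (λ x y → a , b , x , y) (m*n/n≡m c 4) (m/n*n≡m (Rep4⇒4∣mult₂ rep4))

  module _ (N%16≡14 : N % 16 ≡ 14) where

    balanced-mult₂-differs : ∀ {q} → Balanced q → mult₂ q ≢ size₂ q * 4
    balanced-mult₂-differs {a , b , c , d} (((total≡N , _ , (a-odd , _ , c-odd , _)) , _) , refl) refl =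
      contradiction 14≡6 λ ()
      where
      4c²%16≡4 : c * (c * 4) % 16 ≡ 4
      4c²%16≡4 = begin
        c * (c * 4) % 16   ≡⟨ cong (_% 16) (*-assoc c c 4) ⟨
        c * c * 4 % 16     ≡⟨ m%n*o≡m*o%[n*o] (c * c) 4 4 ⟨
        c * c % 4 * 4      ≡⟨ cong (_* 4) (%-∣ (c * c) 4 8 (divides 2 refl) (odd-square-%8 c c-odd)) ⟩
        4                  ∎
        where open ≡-Reasoning
      14≡6 : 14 ≡ 6
      14≡6 = begin
        14                              ≡⟨ N%16≡14 ⟨
        N % 16                          ≡⟨ cong (_% 16) total≡N ⟨
        (a * (a * 2) + c * (c * 4)) % 16 ≡⟨ %-+ (a * (a * 2)) (c * (c * 4)) 16 (twice-odd-square-%16 a a-odd) 4c²%16≡4 ⟩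
        6                               ∎
        where open ≡-Reasoning

    count-Balanced : count Balanced? (candidates N) ≡
                     2 * count (Balanced? ∩? λ q → mult₂ q <? size₂ q * 4) (candidates N)
    count-Balanced =
      count-by-fixpoint-free-involution Balanced? mult₂ (λ q → size₂ q * 4) (candidates-unique N)
        (Rep⊆candidates N ∘ proj₁ ∘ proj₁) rescaleSecond (rescaleSecond-Balanced N%8≡6)
        rescaleSecond-involutive (λ _ → refl) balanced-mult₂-differs
      where N%8≡6 = %-∣ N 8 16 (divides 2 refl) N%16≡14

module Counts (N : ℕ) where

  -- Each #…-pairs counts one member of every two-element orbit of the corresponding involution.
  #ordered #reflect-pairs #central #rescale₁-pairs #rescale₂-pairs : ℕ
  #ordered        = count (Rep? N ∩? Ordered?) (candidates N)
  #reflect-pairs  = count (Diagonal<? N ∩? λ q → mult₁ q <? pivot q ∸ mult₁ q) (candidates N)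
  #central        = count (OddDivisor<? N) (range1 N)
  #rescale₁-pairs = count (Rep4? N ∩? λ q → mult₁ q <? size₁ q * 2) (candidates N)
  #rescale₂-pairs = count (Balanced? N ∩? λ q → mult₂ q <? size₂ q * 4) (candidates N)

  count-Rep-by-diagonal : N % 4 ≡ 2 → N / 2 % 4 ≡ 3 →
                          count (Rep? N) (candidates N) ≡ 2 * (#ordered + #central + #reflect-pairs * 2)
  count-Rep-by-diagonal N%4≡2 N/2%4≡3 = begin
    count (Rep? N) (candidates N)                          ≡⟨ count-Rep-by-order N ⟩
    2 * #ordered + count (Diagonal? N) (candidates N)      ≡⟨ cong (2 * #ordered +_) (count-Diagonal N N%4≡2) ⟩
    2 * #ordered + 2 * count (Diagonal<? N) (candidates N) ≡⟨ cong (λ n → 2 * #ordered + 2 * n) (count-Diagonal< N N%4≡2) ⟩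
    2 * #ordered + 2 * (2 * #reflect-pairs + count (Central? N) (candidates N))
                                                           ≡⟨ cong (λ n → 2 * #ordered + 2 * (2 * #reflect-pairs + n))
                                                                   (count-Central N N%4≡2 N/2%4≡3) ⟩
    2 * #ordered + 2 * (2 * #reflect-pairs + #central)     ≡⟨ rearrange #ordered #reflect-pairs #central ⟩
    2 * (#ordered + #central + #reflect-pairs * 2)         ∎
    where
    open ≡-Reasoning
    rearrange : ∀ x r k → 2 * x + 2 * (2 * r + k) ≡ 2 * (x + k + r * 2)
    rearrange = solve-∀

  count-Rep-by-rescaling : N % 16 ≡ 14 → count (Rep? N) (candidates N) ≡ 2 * ((#rescale₁-pairs + #rescale₂-pairs) * 2)
  count-Rep-by-rescaling N%16≡14 = begin
    count (Rep? N) (candidates N)                           ≡⟨ count-Rep-by-residues N N%4≡2 ⟩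
    2 * count (Rep4? N) (candidates N)                      ≡⟨ cong (2 *_) (count-Rep4 N) ⟩
    2 * (2 * #rescale₁-pairs + count (Balanced? N) (candidates N))
                                                            ≡⟨ cong (λ n → 2 * (2 * #rescale₁-pairs + n)) (count-Balanced N N%16≡14) ⟩
    2 * (2 * #rescale₁-pairs + 2 * #rescale₂-pairs)         ≡⟨ rearrange #rescale₁-pairs #rescale₂-pairs ⟩
    2 * ((#rescale₁-pairs + #rescale₂-pairs) * 2)           ∎
    where
    open ≡-Reasoning
    N%4≡2 = %-∣ N 4 16 (divides 4 refl) N%16≡14
    rearrange : ∀ x y → 2 * (2 * x + 2 * y) ≡ 2 * ((x + y) * 2)
    rearrange = solve-∀

  numDivisors≡4*#central : N % 4 ≡ 2 → N / 2 % 4 ≡ 3 → numDivisors N ≡ (#central + #central) * 2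
  numDivisors≡4*#central N%4≡2 N/2%4≡3 = begin
    numDivisors N                          ≡⟨ numDivisors≡2*oddDivisors N N%4≡2 ⟩
    2 * count (OddDivisor? N) (range1 N)   ≡⟨ cong (2 *_) (count-odd-divisors N N%4≡2 N/2%4≡3) ⟩
    2 * (2 * #central)                     ≡⟨ rearrange #central ⟩
    (#central + #central) * 2              ∎
    where
    open ≡-Reasoning
    rearrange : ∀ k → 2 * (2 * k) ≡ (k + k) * 2
    rearrange = solve-∀

theorem4p2 : (N : ℕ) → N % 16 ≡ 14 →
    (countClass E O E E N + countClass O E O E N) % 4 ≡ (numDivisors N / 2) % 4
theorem4p2 N N%16≡14 = begin
  (countClass E O E E N + countClass O E O E N) % 4  ≡⟨ cong (λ n → (n + countClass O E O E N) % 4) (countClass-conjugate E O E E N) ⟩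
  (countClass O E O E N + countClass O E O E N) % 4  ≡⟨ cong (λ n → (n + n) % 4) (countClass≡count-TwoSize O E O E N) ⟩
  (#ordered + #ordered) % 4                          ≡⟨ double-≡-mod-4 #ordered #central #reflect-pairs
                                                                         (#rescale₁-pairs + #rescale₂-pairs) counts ⟩
  (#central + #central) % 4                          ≡⟨ cong (_% 4) (m*n/n≡m (#central + #central) 2) ⟨
  (#central + #central) * 2 / 2 % 4                  ≡⟨ cong (λ n → n / 2 % 4) (numDivisors≡4*#central N%4≡2 N/2%4≡3) ⟨
  numDivisors N / 2 % 4                              ∎
  where
  open ≡-Reasoning
  open Counts N
  N%4≡2 : N % 4 ≡ 2
  N%4≡2 = %-∣ N 4 16 (divides 4 refl) N%16≡14
  N/2%4≡3 : N / 2 % 4 ≡ 3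
  N/2%4≡3 = half-%4 N (%-∣ N 8 16 (divides 2 refl) N%16≡14)
  counts : #ordered + #central + #reflect-pairs * 2 ≡ (#rescale₁-pairs + #rescale₂-pairs) * 2
  counts = *-cancelˡ-≡ _ _ 2 (trans (sym (count-Rep-by-diagonal N%4≡2 N/2%4≡3)) (count-Rep-by-rescaling N%16≡14))
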